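{- Let $G$ be a connected graph on $n$ vertices and $m$ edges, with maximum degree $\Delta$ and minimum degree $\delta$. Then $$\sigma_{t}(G)\leq \frac{4\left(\sqrt{2mn}-n\sqrt{\delta}\right)\left(n^{2}\Delta^{2}+4m^{2}\right)}{n\sqrt{\delta}}.$$
   Context: For a finite simple graph $G$ with $d(v)$ the degree of $v$, $\sigma_{t}(G)=\sum_{\{u,v\}\subseteq V(G)}(d(u)-d(v))^{2}$, summing over all unordered pairs of distinct vertices. -}

module Defs where

open import Data.Bool using (Bool; true; false; if_then_else_)
open import Data.Nat using (ℕ; zero; suc; _+_; _*_; _⊔_; _⊓_; _<ᵇ_; ∣_-_∣)
open import Data.Fin using (Fin; toℕ)
open import Data.List using (List; map; foldr; allFin)
open import Data.Nat.ListAction using (sum)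
open import Relation.Binary.PropositionalEquality using (_≡_)

record SimpleGraph (n : ℕ) : Set where
  field
    adj   : Fin n → Fin n → Bool
    sym   : ∀ i j → adj i j ≡ adj j i
    irrfl : ∀ i → adj i i ≡ false

open SimpleGraph public

𝟙 : Bool → ℕ
𝟙 true  = 1
𝟙 false = 0

Σv : ∀ {n} → (Fin n → ℕ) → ℕ
Σv {n} f = sum (map f (allFin n))

Σpairs : ∀ {n} → (Fin n → Fin n → ℕ) → ℕ
Σpairs f = Σv (λ i → Σv (λ j → if toℕ i <ᵇ toℕ j then f i j else 0))

deg : ∀ {n} → SimpleGraph n → Fin n → ℕ
deg G i = Σv (λ j → 𝟙 (adj G i j))

edges : ∀ {n} → SimpleGraph n → ℕ
edges G = Σpairs (λ i j → 𝟙 (adj G i j))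

-- maximum degree Δ (0 for the empty graph)
maxDeg : ∀ {n} → SimpleGraph n → ℕ
maxDeg {n} G = foldr (λ i acc → deg G i ⊔ acc) 0 (allFin n)

-- minimum degree δ (every degree is < n, so n is a neutral start value)
minDeg : ∀ {n} → SimpleGraph n → ℕ
minDeg {n} G = foldr (λ i acc → deg G i ⊓ acc) n (allFin n)

sigmaT : ∀ {n} → SimpleGraph n → ℕ
sigmaT G = Σpairs (λ i j → ∣ deg G i - deg G j ∣ * ∣ deg G i - deg G j ∣)

data Reach {n : ℕ} (G : SimpleGraph n) : Fin n → Fin n → Set where
  here : ∀ {i} → Reach G i i
  step : ∀ {i k j} → adj G i k ≡ true → Reach G k j → Reach G i j

Connected : ∀ {n} → SimpleGraph n → Set
Connected G = ∀ i j → Reach G i j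

{-# OPTIONS --safe #-}
module Submission where

-- Write b(v) = d(v) − δ, so that e = Σ b(v) = 2m − nδ. Since |d(u) − d(v)| is at most Δ and
-- at most b(u) + b(v), summing Δ(b(u) + b(v)) over all ordered pairs gives σ ≤ 2(nΔ)e.
-- Put A = (nΔ)² + (2m)². By AM–GM, with nδ ≤ 2m and e ≤ 2m, both 2(nδ)(nΔ) ≤ A and
-- σ ≤ 2(nΔ)e ≤ A; hence n²δσ ≤ A·ne and σ + 8A ≤ 16A, and expanding the square,
--   n²δ(σ + 4A)² = n²δσ(σ + 8A) + 16A²·n²δ ≤ 16A²·(ne + n²δ) = 16A²·2mn.

open import Defs hiding (sym)
open import Data.Nat using (ℕ; _+_; _*_; _≤_; _<_; _∸_; _⊔_; _⊓_; _<ᵇ_; ∣_-_∣; z≤n)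
open import Data.Nat.Properties
open import Data.Nat.Tactic.RingSolver using (solve; solve-∀)
open import Algebra.Properties.CommutativeSemigroup +-commutativeSemigroup
  using () renaming (interchange to +-interchange)
open import Data.Nat.ListAction using (sum)
open import Data.Bool using (true; false; if_then_else_)
open import Data.Empty using (⊥-elim)
open import Data.Sum using (inj₁; inj₂)
open import Data.Fin using (Fin; toℕ)
import Data.Fin.Properties as Fin
open import Data.List using (List; []; _∷_; map; foldr; allFin; length)
open import Data.List.Properties using (length-tabulate; map-cong)
open import Data.List.Membership.Propositional using (_∈_)
open import Data.List.Membership.Propositional.Properties using (∈-allFin)
open import Data.List.Relation.Unary.Any using (here; there)
open import Relation.Nullary using (¬_)
open import Relation.Binary.Definitions using (tri<; tri≈; tri>)
open import Relation.Binary.PropositionalEquality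

module _ {A : Set} where

  sum-map-+ : ∀ (f g : A → ℕ) xs →
              sum (map (λ x → f x + g x) xs) ≡ sum (map f xs) + sum (map g xs)
  sum-map-+ f g []       = refl
  sum-map-+ f g (x ∷ xs) = trans (cong (f x + g x +_) (sum-map-+ f g xs))
                                 (+-interchange (f x) (g x) (sum (map f xs)) (sum (map g xs)))

  sum-map-*ˡ : ∀ c (f : A → ℕ) xs → sum (map (λ x → c * f x) xs) ≡ c * sum (map f xs)
  sum-map-*ˡ c f []       = sym (*-zeroʳ c)
  sum-map-*ˡ c f (x ∷ xs) = trans (cong (c * f x +_) (sum-map-*ˡ c f xs))
                                  (sym (*-distribˡ-+ c (f x) (sum (map f xs))))

  sum-map-const : ∀ c (xs : List A) → sum (map (λ _ → c) xs) ≡ length xs * c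
  sum-map-const c []       = refl
  sum-map-const c (x ∷ xs) = cong (c +_) (sum-map-const c xs)

  sum-map-mono : ∀ {f g : A → ℕ} xs → (∀ x → f x ≤ g x) → sum (map f xs) ≤ sum (map g xs)
  sum-map-mono []       f≤g = z≤n
  sum-map-mono (x ∷ xs) f≤g = +-mono-≤ (f≤g x) (sum-map-mono xs f≤g)

  foldr-⊓-≤ : ∀ (f : A → ℕ) z {xs x} → x ∈ xs → foldr (λ y acc → f y ⊓ acc) z xs ≤ f x
  foldr-⊓-≤ f z (here refl) = m⊓n≤m _ _
  foldr-⊓-≤ f z (there x∈xs) = ≤-trans (m⊓n≤n _ _) (foldr-⊓-≤ f z x∈xs)

  ≤-foldr-⊔ : ∀ (f : A → ℕ) z {xs x} → x ∈ xs → f x ≤ foldr (λ y acc → f y ⊔ acc) z xs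
  ≤-foldr-⊔ f z (here refl) = m≤m⊔n _ _
  ≤-foldr-⊔ f z (there x∈xs) = ≤-trans (≤-foldr-⊔ f z x∈xs) (m≤n⊔m _ _)

sum-map-comm : ∀ {A B : Set} (f : A → B → ℕ) xs ys →
               sum (map (λ x → sum (map (f x) ys)) xs) ≡ sum (map (λ y → sum (map (λ x → f x y) xs)) ys)
sum-map-comm f []       ys = sym (trans (sum-map-const 0 ys) (*-zeroʳ (length ys)))
sum-map-comm f (x ∷ xs) ys = trans (cong (sum (map (f x) ys) +_) (sum-map-comm f xs ys))
                                   (sym (sum-map-+ (f x) (λ y → sum (map (λ x → f x y) xs)) ys))

if-<ᵇ-< : ∀ {m n} x → m < n → (if m <ᵇ n then x else 0) ≡ x
if-<ᵇ-< {m} {n} x m<n with m <ᵇ n | <⇒<ᵇ m<n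
... | true  | _ = refl
... | false | ()

if-<ᵇ-≮ : ∀ {m n} x → ¬ m < n → (if m <ᵇ n then x else 0) ≡ 0
if-<ᵇ-≮ {m} {n} x m≮n with m <ᵇ n | <ᵇ⇒< m n
... | false | _   = refl
... | true  | m<n = ⊥-elim (m≮n (m<n _))

if-≤ : ∀ b x → (if b then x else 0) ≤ x
if-≤ true  x = ≤-refl
if-≤ false x = z≤n

module _ {n : ℕ} where

  Σv-cong : ∀ {f g : Fin n → ℕ} → (∀ i → f i ≡ g i) → Σv f ≡ Σv g
  Σv-cong f≗g = cong sum (map-cong f≗g (allFin n))

  Σv-const : ∀ c → Σv {n} (λ _ → c) ≡ n * c
  Σv-const c = trans (sum-map-const c (allFin n)) (cong (_* c) (length-tabulate {n = n} (λ i → i)))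

  Σv-offset : ∀ c {f : Fin n → ℕ} → (∀ i → c ≤ f i) → Σv f ≡ n * c + Σv (λ i → f i ∸ c)
  Σv-offset c {f} c≤f = begin
      Σv f
    ≡⟨ Σv-cong (λ i → m+[n∸m]≡n (c≤f i)) ⟨
      Σv (λ i → c + (f i ∸ c))
    ≡⟨ sum-map-+ (λ _ → c) (λ i → f i ∸ c) (allFin n) ⟩
      Σv {n} (λ _ → c) + Σv (λ i → f i ∸ c)
    ≡⟨ cong (_+ Σv (λ i → f i ∸ c)) (Σv-const c) ⟩
      n * c + Σv (λ i → f i ∸ c) ∎
    where open ≡-Reasoning

  Σv-Σv-+ : ∀ (f : Fin n → ℕ) → Σv (λ i → Σv (λ j → f i + f j)) ≡ 2 * (n * Σv f)
  Σv-Σv-+ f = begin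
      Σv (λ i → Σv (λ j → f i + f j))
    ≡⟨ Σv-cong (λ i → sum-map-+ (λ _ → f i) f (allFin n)) ⟩
      Σv (λ i → Σv {n} (λ _ → f i) + Σv f)
    ≡⟨ Σv-cong (λ i → cong (_+ Σv f) (Σv-const (f i))) ⟩
      Σv (λ i → n * f i + Σv f)
    ≡⟨ sum-map-+ (λ i → n * f i) (λ _ → Σv f) (allFin n) ⟩
      Σv (λ i → n * f i) + Σv {n} (λ _ → Σv f)
    ≡⟨ cong₂ _+_ (sum-map-*ˡ n f (allFin n)) (Σv-const (Σv f)) ⟩
      n * Σv f + n * Σv f
    ≡⟨ cong (n * Σv f +_) (+-identityʳ (n * Σv f)) ⟨
      2 * (n * Σv f) ∎
    where open ≡-Reasoning

  ordered : (Fin n → Fin n → ℕ) → Fin n → Fin n → ℕ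
  ordered f i j = if toℕ i <ᵇ toℕ j then f i j else 0

  ordered-split : ∀ (f : Fin n → Fin n → ℕ) → (∀ i j → f i j ≡ f j i) → (∀ i → f i i ≡ 0) →
                  ∀ i j → f i j ≡ ordered f i j + ordered f j i
  ordered-split f f-sym f-diag i j with Fin.<-cmp i j
  ... | tri< i<j _ j≮i = sym (trans (cong₂ _+_ (if-<ᵇ-< (f i j) i<j) (if-<ᵇ-≮ (f j i) j≮i))
                                    (+-identityʳ (f i j)))
  ... | tri≈ _ refl _  = trans (f-diag i) (sym (cong₂ _+_ (if-<ᵇ-≮ {toℕ i} (f i i) (<-irrefl refl))
                                                          (if-<ᵇ-≮ {toℕ i} (f i i) (<-irrefl refl))))
  ... | tri> i≮j _ j<i = trans (f-sym i j) (sym (cong₂ _+_ (if-<ᵇ-≮ (f i j) i≮j) (if-<ᵇ-< (f j i) j<i)))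

  Σpairs≤Σv-Σv : ∀ (f : Fin n → Fin n → ℕ) → Σpairs f ≤ Σv (λ i → Σv (f i))
  Σpairs≤Σv-Σv f = sum-map-mono (allFin n) (λ i → sum-map-mono (allFin n) (λ j → if-≤ _ (f i j)))

  Σv-Σv≡2*Σpairs : ∀ (f : Fin n → Fin n → ℕ) → (∀ i j → f i j ≡ f j i) → (∀ i → f i i ≡ 0) →
                   Σv (λ i → Σv (f i)) ≡ 2 * Σpairs f
  Σv-Σv≡2*Σpairs f f-sym f-diag = begin
      Σv (λ i → Σv (f i))
    ≡⟨ Σv-cong (λ i → Σv-cong (ordered-split f f-sym f-diag i)) ⟩
      Σv (λ i → Σv (λ j → ordered f i j + ordered f j i))
    ≡⟨ Σv-cong (λ i → sum-map-+ (ordered f i) (λ j → ordered f j i) (allFin n)) ⟩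
      Σv (λ i → Σv (ordered f i) + Σv (λ j → ordered f j i))
    ≡⟨ sum-map-+ (λ i → Σv (ordered f i)) (λ i → Σv (λ j → ordered f j i)) (allFin n) ⟩
      Σpairs f + Σv (λ i → Σv (λ j → ordered f j i))
    ≡⟨ cong (Σpairs f +_) (sum-map-comm (ordered f) (allFin n) (allFin n)) ⟨
      Σpairs f + Σpairs f
    ≡⟨ cong (Σpairs f +_) (+-identityʳ (Σpairs f)) ⟨
      2 * Σpairs f ∎
    where open ≡-Reasoning

∣m-n∣≤[m∸o]+[n∸o] : ∀ {m n o} → o ≤ m → o ≤ n → ∣ m - n ∣ ≤ (m ∸ o) + (n ∸ o)
∣m-n∣≤[m∸o]+[n∸o] {m} {n} {o} o≤m o≤n = begin
  ∣ m - n ∣                     ≡⟨ cong₂ ∣_-_∣ (m+[n∸m]≡n o≤m) (m+[n∸m]≡n o≤n) ⟨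
  ∣ o + (m ∸ o) - o + (n ∸ o) ∣ ≡⟨ ∣m+n-m+o∣≡∣n-o∣ o (m ∸ o) (n ∸ o) ⟩
  ∣ m ∸ o - n ∸ o ∣             ≤⟨ ∣m-n∣≤m⊔n (m ∸ o) (n ∸ o) ⟩
  (m ∸ o) ⊔ (n ∸ o)             ≤⟨ m⊔n≤m+n (m ∸ o) (n ∸ o) ⟩
  (m ∸ o) + (n ∸ o)             ∎
  where open ≤-Reasoning

∣m-n∣*∣m-n∣≤p*[[m∸o]+[n∸o]] : ∀ {m n o p} → o ≤ m → o ≤ n → m ≤ p → n ≤ p →
                              ∣ m - n ∣ * ∣ m - n ∣ ≤ p * ((m ∸ o) + (n ∸ o))
∣m-n∣*∣m-n∣≤p*[[m∸o]+[n∸o]] {m} {n} o≤m o≤n m≤p n≤p =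
  *-mono-≤ (≤-trans (∣m-n∣≤m⊔n m n) (⊔-lub m≤p n≤p)) (∣m-n∣≤[m∸o]+[n∸o] o≤m o≤n)

m≤n⇒2*m*n≤m*m+n*n : ∀ {m n} → m ≤ n → 2 * m * n ≤ m * m + n * n
m≤n⇒2*m*n≤m*m+n*n {m} {n} m≤n =
  subst (λ n → 2 * m * n ≤ m * m + n * n) (m+[n∸m]≡n m≤n) (gap m (n ∸ m))
  where
    square-gap : ∀ m k → 2 * m * (m + k) + k * k ≡ m * m + (m + k) * (m + k)
    square-gap = solve-∀
    gap : ∀ m k → 2 * m * (m + k) ≤ m * m + (m + k) * (m + k)
    gap m k = subst (2 * m * (m + k) ≤_) (square-gap m k) (m≤m+n _ (k * k))

2*m*n≤m*m+n*n : ∀ m n → 2 * m * n ≤ m * m + n * n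
2*m*n≤m*m+n*n m n with ≤-total m n
... | inj₁ m≤n = m≤n⇒2*m*n≤m*m+n*n m≤n
... | inj₂ n≤m = subst₂ _≤_ (swap-factors n m) (+-comm (n * n) (m * m)) (m≤n⇒2*m*n≤m*m+n*n n≤m)
  where
    swap-factors : ∀ m n → 2 * m * n ≡ 2 * n * m
    swap-factors = solve-∀

m≤o⇒2*m*n≤n*n+o*o : ∀ {m o} n → m ≤ o → 2 * m * n ≤ n * n + o * o
m≤o⇒2*m*n≤n*n+o*o {m} {o} n m≤o = begin
  2 * m * n     ≤⟨ 2*m*n≤m*m+n*n m n ⟩
  m * m + n * n ≤⟨ +-monoˡ-≤ (n * n) (*-mono-≤ m≤o m≤o) ⟩
  o * o + n * n ≡⟨ +-comm (o * o) (n * n) ⟩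
  n * n + o * o ∎
  where open ≤-Reasoning

expanded-square-bound : ∀ N d e σ A → N * N * d * σ ≤ A * (N * e) → σ ≤ A →
                        N * N * d * ((σ + 4 * A) * (σ + 4 * A)) ≤ 16 * (A * A) * ((N * d + e) * N)
expanded-square-bound N d e σ A N*N*d*σ≤A*[N*e] σ≤A = begin
    N * N * d * ((σ + 4 * A) * (σ + 4 * A))
  ≡⟨ solve (N ∷ d ∷ σ ∷ A ∷ []) ⟩
    N * N * d * σ * (σ + 8 * A) + 16 * (A * A) * (N * (N * d))
  ≤⟨ +-monoˡ-≤ _ (*-mono-≤ N*N*d*σ≤A*[N*e] σ+8*A≤16*A) ⟩
    A * (N * e) * (16 * A) + 16 * (A * A) * (N * (N * d))
  ≡⟨ solve (N ∷ d ∷ e ∷ A ∷ []) ⟩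
    16 * (A * A) * ((N * d + e) * N) ∎
  where
    open ≤-Reasoning
    σ+8*A≤16*A : σ + 8 * A ≤ 16 * A
    σ+8*A≤16*A = begin
      σ + 8 * A     ≤⟨ +-monoˡ-≤ (8 * A) (≤-trans σ≤A (m≤n*m A 8)) ⟩
      8 * A + 8 * A ≡⟨ *-distribʳ-+ A 8 8 ⟨
      16 * A        ∎

squared-bound : ∀ N d e P σ M → M ≡ N * d + e → σ ≤ 2 * P * e →
                let A = P * P + M * M in
                N * N * d * ((σ + 4 * A) * (σ + 4 * A)) ≤ 16 * (A * A) * (M * N)
squared-bound N d e P σ M refl σ≤2Pe =
  expanded-square-bound N d e σ (P * P + M * M) N*N*d*σ≤A*[N*e] σ≤A
  where
    open ≤-Reasoning
    σ≤A : σ ≤ P * P + M * M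
    σ≤A = begin
      σ         ≤⟨ σ≤2Pe ⟩
      2 * P * e ≡⟨ solve (P ∷ e ∷ []) ⟩
      2 * e * P ≤⟨ m≤o⇒2*m*n≤n*n+o*o P (m≤n+m e (N * d)) ⟩
      P * P + M * M ∎
    N*N*d*σ≤A*[N*e] : N * N * d * σ ≤ (P * P + M * M) * (N * e)
    N*N*d*σ≤A*[N*e] = begin
      N * N * d * σ             ≤⟨ *-monoʳ-≤ (N * N * d) σ≤2Pe ⟩
      N * N * d * (2 * P * e)   ≡⟨ solve (N ∷ d ∷ P ∷ e ∷ []) ⟩
      2 * (N * d) * P * (N * e) ≤⟨ *-monoˡ-≤ (N * e) (m≤o⇒2*m*n≤n*n+o*o P (m≤m+n (N * d) e)) ⟩
      (P * P + M * M) * (N * e) ∎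

module _ {n : ℕ} (G : SimpleGraph n) where

  minDeg≤deg : ∀ i → minDeg G ≤ deg G i
  minDeg≤deg i = foldr-⊓-≤ (deg G) n (∈-allFin i)

  deg≤maxDeg : ∀ i → deg G i ≤ maxDeg G
  deg≤maxDeg i = ≤-foldr-⊔ (deg G) 0 (∈-allFin i)

  handshake : Σv (deg G) ≡ 2 * edges G
  handshake = Σv-Σv≡2*Σpairs (λ i j → 𝟙 (adj G i j))
                             (λ i j → cong 𝟙 (SimpleGraph.sym G i j)) (λ i → cong 𝟙 (irrfl G i))

  excess : ℕ
  excess = Σv (λ i → deg G i ∸ minDeg G)

  2*edges≡n*minDeg+excess : 2 * edges G ≡ n * minDeg G + excess
  2*edges≡n*minDeg+excess = trans (sym handshake) (Σv-offset (minDeg G) minDeg≤deg)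

  sigmaT≤2*n*maxDeg*excess : sigmaT G ≤ 2 * (n * maxDeg G) * excess
  sigmaT≤2*n*maxDeg*excess = begin
      sigmaT G
    ≤⟨ Σpairs≤Σv-Σv (λ i j → ∣ d i - d j ∣ * ∣ d i - d j ∣) ⟩
      Σv (λ i → Σv (λ j → ∣ d i - d j ∣ * ∣ d i - d j ∣))
    ≤⟨ sum-map-mono (allFin n) (λ i → sum-map-mono (allFin n) (λ j →
         ∣m-n∣*∣m-n∣≤p*[[m∸o]+[n∸o]] (minDeg≤deg i) (minDeg≤deg j) (deg≤maxDeg i) (deg≤maxDeg j))) ⟩
      Σv (λ i → Σv (λ j → Δ * (b i + b j)))
    ≡⟨ Σv-cong (λ i → sum-map-*ˡ Δ (λ j → b i + b j) (allFin n)) ⟩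
      Σv (λ i → Δ * Σv (λ j → b i + b j))
    ≡⟨ sum-map-*ˡ Δ (λ i → Σv (λ j → b i + b j)) (allFin n) ⟩
      Δ * Σv (λ i → Σv (λ j → b i + b j))
    ≡⟨ cong (Δ *_) (Σv-Σv-+ b) ⟩
      Δ * (2 * (n * excess))
    ≡⟨ reassociate Δ n excess ⟩
      2 * (n * Δ) * excess ∎
    where
      open ≤-Reasoning
      d = deg G
      Δ = maxDeg G
      b : Fin n → ℕ
      b i = d i ∸ minDeg G
      reassociate : ∀ p m k → p * (2 * (m * k)) ≡ 2 * (m * p) * k
      reassociate = solve-∀

proposition12 : ∀ (n : ℕ) (G : SimpleGraph n) → Connected G →
    let m = edges G
        Δ = maxDeg G
        δ = minDeg G
        σ = sigmaT G
        A = n * n * (Δ * Δ) + 4 * (m * m)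
    in n * n * δ * ((σ + 4 * A) * (σ + 4 * A)) ≤ 16 * (A * A) * (2 * m * n)
proposition12 n G _ =
  subst (λ A → n * n * δ * ((σ + 4 * A) * (σ + 4 * A)) ≤ 16 * (A * A) * (2 * m * n))
        (square-sum m Δ)
        (squared-bound n δ (excess G) (n * Δ) σ (2 * m)
                       (2*edges≡n*minDeg+excess G) (sigmaT≤2*n*maxDeg*excess G))
  where
    m = edges G
    Δ = maxDeg G
    δ = minDeg G
    σ = sigmaT G
    square-sum : ∀ m Δ → n * Δ * (n * Δ) + 2 * m * (2 * m) ≡ n * n * (Δ * Δ) + 4 * (m * m)
    square-sum m Δ = solve (n ∷ m ∷ Δ ∷ [])
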